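{- Let $G$ be a connected $P_5$-free chordal bipartite graph of order $2n$. Then $G$ is Hamiltonian if and only if $G$ is bipancyclic.
   Context: Graphs are finite, simple and undirected. A bipartite graph is chordal bipartite if every cycle of length at least six has a chord. $P_5$-free means no induced path on five vertices. A graph of order $2n$ is bipancyclic if it contains a cycle of length $2l$ for every $l$ with $2\le l\le n$. -}

module Defs where

open import Data.Nat using (ℕ; zero; suc; _≤_; _*_)
open import Data.Fin using (Fin; toℕ)
open import Data.Bool using (Bool)
open import Data.Product using (Σ; ∃; _×_; _,_)
open import Data.Sum using (_⊎_)
open import Relation.Nullary using (¬_; Dec)
open import Relation.Binary.PropositionalEquality using (_≡_; _≢_)
open import Function.Definitions using (Injective)
open import Function.Bundles using (_⇔_)

record Graph (m : ℕ) : Set₁ where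
  field
    Adj    : Fin m → Fin m → Set
    adj?   : ∀ u v → Dec (Adj u v)
    sym    : ∀ {u v} → Adj u v → Adj v u
    irrefl : ∀ {u} → ¬ Adj u u
open Graph public

module _ {m : ℕ} (G : Graph m) where

  data Reach : Fin m → Fin m → Set where
    here : ∀ {u} → Reach u u
    step : ∀ {u v w} → Adj G u v → Reach v w → Reach u w

  Connected : Set
  Connected = ∀ u v → Reach u v

  Bipartite : Set
  Bipartite = Σ (Fin m → Bool) λ f → ∀ {u v} → Adj G u v → f u ≢ f v

  CycAdj : (k : ℕ) → Fin k → Fin k → Set
  CycAdj k i j =
      suc (toℕ i) ≡ toℕ j
    ⊎ suc (toℕ j) ≡ toℕ i
    ⊎ (toℕ i ≡ 0 × suc (toℕ j) ≡ k)
    ⊎ (toℕ j ≡ 0 × suc (toℕ i) ≡ k)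

  IsCycle : (k : ℕ) → (Fin k → Fin m) → Set
  IsCycle k c = 3 ≤ k × Injective _≡_ _≡_ c × (∀ i j → CycAdj k i j → Adj G (c i) (c j))

  HasCycleOfLength : ℕ → Set
  HasCycleOfLength k = Σ (Fin k → Fin m) (IsCycle k)

  HasChord : (k : ℕ) → (Fin k → Fin m) → Set
  HasChord k c = Σ (Fin k) λ i → Σ (Fin k) λ j → Adj G (c i) (c j) × ¬ CycAdj k i j

  ChordalBipartite : Set
  ChordalBipartite = Bipartite × (∀ k (c : Fin k → Fin m) → 6 ≤ k → IsCycle k c → HasChord k c)

  IsInducedP5 : (Fin 5 → Fin m) → Set
  IsInducedP5 p = Injective _≡_ _≡_ p ×
    (∀ i j → Adj G (p i) (p j) ⇔ (suc (toℕ i) ≡ toℕ j ⊎ suc (toℕ j) ≡ toℕ i))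

  P5Free : Set
  P5Free = ∀ (p : Fin 5 → Fin m) → ¬ IsInducedP5 p

  Hamiltonian : Set
  Hamiltonian = HasCycleOfLength m

Bipancyclic : (n : ℕ) → Graph (2 * n) → Set
Bipancyclic n G = ∀ l → 2 ≤ l → l ≤ n → HasCycleOfLength G (2 * l)

-- In a chordal bipartite graph every cycle of length at least 6 can be shortened by 2.
-- Along such a cycle, a chord of minimal span has span 3: an even span would join two
-- vertices of the same colour, and a chord of span d ≥ 5 closes, together with the arc
-- it spans, a cycle of length d + 1 ≥ 6, whose own chord has a smaller span.  Using the
-- span-3 chord to bypass the two vertices it spans leaves a cycle two shorter.
-- Starting from a Hamiltonian cycle this yields every even length down to 4; the
-- converse is the case l = n.
module Submission where

open import Defs renaming (sym to Adj-sym)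
open import Data.Bool using (Bool; not)
open import Data.Bool.Properties using (not-involutive; ¬-not)
open import Data.Empty using (⊥-elim)
open import Data.Fin using (Fin; toℕ)
open import Data.Fin.Properties using (toℕ-injective; toℕ<n; toℕ-fromℕ<)
open import Data.Nat using (ℕ; zero; suc; _+_; _*_; _∸_; _≤_; _<_; z≤n; s≤s; s≤s⁻¹; z<s)
open import Data.Nat.DivMod using (_mod_; m<n⇒m%n≡m)
open import Data.Nat.GeneralisedArithmetic using (iterate)
open import Data.Nat.Induction using (<-wellFounded)
open import Data.Nat.Properties
open import Data.Product using (Σ; _×_; _,_; proj₁; proj₂)
open import Data.Sum using (inj₁; inj₂)
open import Function.Base using (_∘_)
open import Induction.WellFounded using (Acc; acc)
open import Relation.Binary.Definitions using (tri<; tri≈; tri>)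
open import Relation.Binary.PropositionalEquality
open import Relation.Nullary using (¬_)

-- skip₂ a enumerates ℕ without a + 1 and a + 2.
skip₂ : ℕ → ℕ → ℕ
skip₂ a       zero    = zero
skip₂ zero    (suc t) = 3 + t
skip₂ (suc a) (suc t) = suc (skip₂ a t)

skip₂-≤ : ∀ {a t} → t ≤ a → skip₂ a t ≡ t
skip₂-≤ {t = zero}      _         = refl
skip₂-≤ {suc a} {suc t} (s≤s t≤a) = cong suc (skip₂-≤ t≤a)

skip₂-> : ∀ {a t} → a < t → skip₂ a t ≡ 2 + t
skip₂-> {zero}  {suc t} _         = refl
skip₂-> {suc a} {suc t} (s≤s a<t) = cong suc (skip₂-> a<t)

skip₂-≤-2+ : ∀ a t → skip₂ a t ≤ 2 + t
skip₂-≤-2+ a       zero    = z≤n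
skip₂-≤-2+ zero    (suc t) = ≤-refl
skip₂-≤-2+ (suc a) (suc t) = s≤s (skip₂-≤-2+ a t)

skip₂-injective : ∀ a {t u} → skip₂ a t ≡ skip₂ a u → t ≡ u
skip₂-injective a       {zero}  {zero}  _    = refl
skip₂-injective zero    {zero}  {suc u} ()
skip₂-injective (suc a) {zero}  {suc u} ()
skip₂-injective zero    {suc t} {zero}  ()
skip₂-injective (suc a) {suc t} {zero}  ()
skip₂-injective zero    {suc t} {suc u} refl = refl
skip₂-injective (suc a) {suc t} {suc u} eq   = cong suc (skip₂-injective a (suc-injective eq))

nonconsecutive⇒2≤span : ∀ {x y} → x < y → suc x ≢ y → 2 ≤ y ∸ x
nonconsecutive⇒2≤span {x} {y} x<y ¬succ =
  subst (_≤ y ∸ x) (m+n∸n≡m 2 x) (∸-monoˡ-≤ x (≤∧≢⇒< x<y ¬succ))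

nonwrapping⇒1+span< : ∀ {x y k} → x < y → y < k → ¬ (x ≡ 0 × suc y ≡ k) → suc (y ∸ x) < k
nonwrapping⇒1+span< {zero}  _   y<k ¬wrap = ≤∧≢⇒< y<k (λ sy≡k → ¬wrap (refl , sy≡k))
nonwrapping⇒1+span< {suc x} x<y y<k _     = ≤-trans (s≤s (∸-monoʳ-< z<s (<⇒≤ x<y))) y<k

module _ {m : ℕ} (G : Graph m) where

  -- A cycle of length L as a sequence g 0, …, g (L - 1); values beyond are irrelevant.
  record IsCycleℕ (L : ℕ) (g : ℕ → Fin m) : Set where
    field
      injective : ∀ {a b} → a < L → b < L → g a ≡ g b → a ≡ b
      adj-suc   : ∀ {a} → suc a < L → Adj G (g a) (g (suc a))
      adj-wrap  : ∀ {a} → suc a ≡ L → Adj G (g a) (g 0)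

  open IsCycleℕ

  IsCycleℕ⇒IsCycle : ∀ {L g} → 3 ≤ L → IsCycleℕ L g → IsCycle G L (g ∘ toℕ)
  IsCycleℕ⇒IsCycle {L} {g} 3≤L cyc =
    3≤L , (λ {i} {j} eq → toℕ-injective (injective cyc (toℕ<n i) (toℕ<n j) eq)) , adj
    where
    adj : ∀ i j → CycAdj G L i j → Adj G (g (toℕ i)) (g (toℕ j))
    adj i j (inj₁ eq) =
      subst (Adj G (g (toℕ i)) ∘ g) eq (adj-suc cyc (subst (_< L) (sym eq) (toℕ<n j)))
    adj i j (inj₂ (inj₁ eq)) = Adj-sym G (adj j i (inj₁ eq))
    adj i j (inj₂ (inj₂ (inj₁ (i≡0 , eq)))) =
      Adj-sym G (subst (Adj G (g (toℕ j)) ∘ g) (sym i≡0) (adj-wrap cyc eq))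
    adj i j (inj₂ (inj₂ (inj₂ (j≡0 , eq)))) =
      subst (Adj G (g (toℕ i)) ∘ g) (sym j≡0) (adj-wrap cyc eq)

  HasCycleOfLength⇒IsCycleℕ : ∀ {L} → HasCycleOfLength G L → Σ (ℕ → Fin m) (IsCycleℕ L)
  HasCycleOfLength⇒IsCycleℕ {zero}  (_ , () , _)
  HasCycleOfLength⇒IsCycleℕ {suc L} (c , _ , c-inj , c-adj) =
    c ∘ (_mod suc L) , record { injective = inj ; adj-suc = adj-suc′ ; adj-wrap = adj-wrap′ }
    where
    toℕ-mod : ∀ {t} → t < suc L → toℕ (t mod suc L) ≡ t
    toℕ-mod t<L = trans (toℕ-fromℕ< _) (m<n⇒m%n≡m t<L)
    inj : ∀ {a b} → a < suc L → b < suc L → c (a mod suc L) ≡ c (b mod suc L) → a ≡ b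
    inj a<L b<L eq = trans (sym (toℕ-mod a<L)) (trans (cong toℕ (c-inj eq)) (toℕ-mod b<L))
    adj-suc′ : ∀ {a} → suc a < suc L → Adj G (c (a mod suc L)) (c (suc a mod suc L))
    adj-suc′ sa<L = c-adj _ _ (inj₁ (trans (cong suc (toℕ-mod (<-trans (n<1+n _) sa<L)))
                                            (sym (toℕ-mod sa<L))))
    adj-wrap′ : ∀ {a} → suc a ≡ suc L → Adj G (c (a mod suc L)) (c (0 mod suc L))
    adj-wrap′ {a} eq = c-adj _ _ (inj₂ (inj₂ (inj₂ (toℕ-mod {0} z<s ,
                         trans (cong suc (toℕ-mod (subst (a <_) eq (n<1+n a)))) eq))))

  chord-cycle : ∀ {L g i d} → IsCycleℕ L g → i + d < L → Adj G (g i) (g (i + d)) →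
                IsCycleℕ (suc d) (λ t → g (i + t))
  chord-cycle {L} {g} {i} {d} cyc i+d<L chord = record
    { injective = λ a<d b<d eq → +-cancelˡ-≡ i _ _ (injective cyc (bound a<d) (bound b<d) eq)
    ; adj-suc   = λ {a} sa<d → subst (Adj G (g (i + a)) ∘ g) (sym (+-suc i a))
                                 (adj-suc cyc (subst (_< L) (+-suc i a) (bound sa<d)))
    ; adj-wrap  = λ {a} eq → subst₂ (λ u v → Adj G (g u) (g v))
                                 (cong (i +_) (suc-injective (sym eq))) (sym (+-identityʳ i))
                                 (Adj-sym G chord)
    }
    where
    bound : ∀ {t} → t < suc d → i + t < L
    bound t<d = ≤-<-trans (+-monoʳ-≤ i (s≤s⁻¹ t<d)) i+d<L

  shortcut : ∀ {L g a} → IsCycleℕ (2 + L) g → a + 3 < 2 + L → Adj G (g a) (g (a + 3)) →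
             IsCycleℕ L (g ∘ skip₂ a)
  shortcut {L} {g} {a} cyc a+3<L chord = record
    { injective = λ t<L u<L eq → skip₂-injective a (injective cyc (bound t<L) (bound u<L) eq)
    ; adj-suc   = adj-suc′
    ; adj-wrap  = adj-wrap′
    }
    where
    bound : ∀ {t} → t < L → skip₂ a t < 2 + L
    bound {t} t<L = ≤-<-trans (skip₂-≤-2+ a t) (s≤s (s≤s t<L))
    adj-at : ∀ t u {t′ u′} → skip₂ a t ≡ t′ → skip₂ a u ≡ u′ →
             Adj G (g t′) (g u′) → Adj G (g (skip₂ a t)) (g (skip₂ a u))
    adj-at _ _ eq eq′ = subst₂ (λ x y → Adj G (g x) (g y)) (sym eq) (sym eq′)
    adj-suc′ : ∀ {t} → suc t < L → Adj G (g (skip₂ a t)) (g (skip₂ a (suc t)))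
    adj-suc′ {t} st<L with <-cmp t a
    ... | tri< t<a _ _ = adj-at t (suc t) (skip₂-≤ (<⇒≤ t<a)) (skip₂-≤ t<a)
                                (adj-suc cyc (<-trans st<L (m<n+m L z<s)))
    ... | tri≈ _ refl _ = adj-at t (suc t) (skip₂-≤ ≤-refl) (trans (skip₂-> (n<1+n t)) (+-comm 3 t))
                                 chord
    ... | tri> _ _ a<t = adj-at t (suc t) (skip₂-> a<t) (skip₂-> (<-trans a<t (n<1+n t)))
                                (adj-suc cyc (s≤s (s≤s st<L)))
    adj-wrap′ : ∀ {t} → suc t ≡ L → Adj G (g (skip₂ a t)) (g (skip₂ a 0))
    adj-wrap′ {t} eq = adj-at t 0 (skip₂-> a<t) refl (adj-wrap cyc (cong (2 +_) eq))
      where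
      a<t : a < t
      a<t = +-cancelʳ-< 3 a t (subst (a + 3 <_) (trans (cong (2 +_) (sym eq)) (+-comm 3 t)) a+3<L)

  Span3Chord : ℕ → (ℕ → Fin m) → Set
  Span3Chord L g = Σ ℕ λ a → a + 3 < L × Adj G (g a) (g (a + 3))

  SpanChord : ℕ → (ℕ → Fin m) → Set
  SpanChord k h = Σ ℕ λ x → Σ ℕ λ e → 2 ≤ e × suc e < k × x + e < k × Adj G (h x) (h (x + e))

  ordered-chord⇒SpanChord : ∀ {k x y} (h : ℕ → Fin m) → x < y → y < k → Adj G (h x) (h y) →
                            suc x ≢ y → ¬ (x ≡ 0 × suc y ≡ k) → SpanChord k h
  ordered-chord⇒SpanChord {k} {x} {y} h x<y y<k chord ¬succ ¬wrap =
    x , y ∸ x , nonconsecutive⇒2≤span x<y ¬succ , nonwrapping⇒1+span< x<y y<k ¬wrap ,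
    subst (_< k) (sym x+e≡y) y<k , subst (Adj G (h x) ∘ h) (sym x+e≡y) chord
    where
    x+e≡y = m+[n∸m]≡n (<⇒≤ x<y)

  HasChord⇒SpanChord : ∀ {k} (h : ℕ → Fin m) → HasChord G k (h ∘ toℕ) → SpanChord k h
  HasChord⇒SpanChord h (i , j , chord , ¬cyc) with <-cmp (toℕ i) (toℕ j)
  ... | tri< i<j _ _ = ordered-chord⇒SpanChord h i<j (toℕ<n j) chord
                         (¬cyc ∘ inj₁) (¬cyc ∘ inj₂ ∘ inj₂ ∘ inj₁)
  ... | tri≈ _ i≡j _ = ⊥-elim (irrefl G (subst (Adj G (h (toℕ i)) ∘ h) (sym i≡j) chord))
  ... | tri> _ _ j<i = ordered-chord⇒SpanChord h j<i (toℕ<n i) (Adj-sym G chord)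
                         (¬cyc ∘ inj₂ ∘ inj₁) (¬cyc ∘ inj₂ ∘ inj₂ ∘ inj₂)

module _ {m : ℕ} {G : Graph m} where

  open IsCycleℕ

  module _ (colour : Fin m → Bool) (proper : ∀ {u v} → Adj G u v → colour u ≢ colour v) where

    colour-alternates : ∀ {L g} → IsCycleℕ G L g → ∀ i t → i + t < L →
                        colour (g (i + t)) ≡ iterate not (colour (g i)) t
    colour-alternates {g = g} cyc i zero _ = cong (colour ∘ g) (+-identityʳ i)
    colour-alternates {L} {g} cyc i (suc t) i+t<L = begin
      colour (g (i + suc t))              ≡⟨ cong (colour ∘ g) (+-suc i t) ⟩
      colour (g (suc i + t))              ≡⟨ colour-alternates cyc (suc i) t 1+i+t<L ⟩
      iterate not (colour (g (suc i))) t  ≡⟨ cong (λ b → iterate not b t) colour-flips ⟩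
      iterate not (not (colour (g i))) t  ∎
      where
      open ≡-Reasoning
      1+i+t<L : suc i + t < L
      1+i+t<L = subst (_< L) (+-suc i t) i+t<L
      colour-flips : colour (g (suc i)) ≡ not (colour (g i))
      colour-flips = ¬-not (proper (Adj-sym G (adj-suc cyc (≤-<-trans (s≤s (m≤m+n i t)) 1+i+t<L))))

  module _ (chordal-bipartite : ChordalBipartite G) where

    private
      colour = proj₁ (proj₁ chordal-bipartite)
      proper = proj₂ (proj₁ chordal-bipartite)
      chordal = proj₂ chordal-bipartite

    inner-chord : ∀ {L g i d} → IsCycleℕ G L g → 5 ≤ d → i + d < L → Adj G (g i) (g (i + d)) →
                  SpanChord G (suc d) (λ t → g (i + t))
    inner-chord cyc 5≤d i+d<L chord =
      HasChord⇒SpanChord G _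
        (chordal _ _ (s≤s 5≤d) (IsCycleℕ⇒IsCycle G 3≤1+d (chord-cycle G cyc i+d<L chord)))
      where
      3≤1+d = s≤s (≤-trans (s≤s (s≤s z≤n)) 5≤d)

    span-3-chord : ∀ {L g} → IsCycleℕ G L g → ∀ {d} → Acc _<_ d → ∀ {i} →
                   2 ≤ d → i + d < L → Adj G (g i) (g (i + d)) → Span3Chord G L g
    span-3-chord cyc {0} _ () _ _
    span-3-chord cyc {1} _ (s≤s ()) _ _
    span-3-chord cyc {2} _ _ i+2<L chord =
      ⊥-elim (proper chord (sym (trans (colour-alternates colour proper cyc _ 2 i+2<L)
                                       (not-involutive _))))
    span-3-chord cyc {3} _ _ i+3<L chord = _ , i+3<L , chord
    span-3-chord cyc {4} _ _ i+4<L chord =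
      ⊥-elim (proper chord (sym (trans (colour-alternates colour proper cyc _ 4 i+4<L)
                                       (trans (not-involutive _) (not-involutive _)))))
    span-3-chord {L} {g} cyc {suc (suc (suc (suc (suc _))))} (acc smaller) {i} _ i+d<L chord
      with inner-chord cyc (s≤s (s≤s (s≤s (s≤s (s≤s z≤n))))) i+d<L chord
    ... | x , e , 2≤e , 1+e<1+d , x+e<1+d , chord′ =
      span-3-chord cyc (smaller (s≤s⁻¹ 1+e<1+d)) 2≤e
        (subst (_< L) (sym (+-assoc i x e)) (≤-<-trans (+-monoʳ-≤ i (s≤s⁻¹ x+e<1+d)) i+d<L))
        (subst (Adj G (g (i + x)) ∘ g) (sym (+-assoc i x e)) chord′)

    shorter-cycle : ∀ {L} → 4 ≤ L → HasCycleOfLength G (2 + L) → HasCycleOfLength G L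
    shorter-cycle {L} 4≤L c with HasCycleOfLength⇒IsCycleℕ G c
    ... | g , cyc with span-3-chord cyc (<-wellFounded (suc L)) {0} (s≤s (≤-trans (s≤s z≤n) 4≤L))
                         ≤-refl (Adj-sym G (adj-wrap cyc refl))
    ... | a , a+3<L , chord =
      _ , IsCycleℕ⇒IsCycle G (≤-trans (n≤1+n 3) 4≤L) (shortcut G cyc a+3<L chord)

    even-shorter-cycle : ∀ {L} → 4 ≤ L → ∀ e → HasCycleOfLength G (e * 2 + L) →
                         HasCycleOfLength G L
    even-shorter-cycle 4≤L zero    c = c
    even-shorter-cycle {L} 4≤L (suc e) c =
      even-shorter-cycle 4≤L e (shorter-cycle (≤-trans 4≤L (m≤n+m L (e * 2))) c)

theorem7 : (n : ℕ) → 2 ≤ n → (G : Graph (2 * n)) →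
    Connected G → P5Free G → ChordalBipartite G →
    (Hamiltonian G → Bipancyclic n G) × (Bipancyclic n G → Hamiltonian G)
theorem7 n 2≤n G _ _ chordal-bipartite =
  hamiltonian⇒bipancyclic , (λ bipancyclic → bipancyclic n 2≤n ≤-refl)
  where
  hamiltonian⇒bipancyclic : Hamiltonian G → Bipancyclic n G
  hamiltonian⇒bipancyclic hamiltonian l 2≤l l≤n =
    even-shorter-cycle {G = G} chordal-bipartite (*-monoʳ-≤ 2 2≤l) (n ∸ l)
      (subst (HasCycleOfLength G) (sym length-split) hamiltonian)
    where
    open ≡-Reasoning
    length-split : (n ∸ l) * 2 + 2 * l ≡ 2 * n
    length-split = begin
      (n ∸ l) * 2 + 2 * l  ≡⟨ cong (_+ 2 * l) (*-comm (n ∸ l) 2) ⟩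
      2 * (n ∸ l) + 2 * l  ≡⟨ *-distribˡ-+ 2 (n ∸ l) l ⟨
      2 * (n ∸ l + l)      ≡⟨ cong (2 *_) (m∸n+n≡m l≤n) ⟩
      2 * n                ∎
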